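{- Let $a,b,k,d\in\mathbb{N}$ with $a,b>1$, $\gcd(a,b)=1$, and $d\mid a$, and let $S=\langle a^k,a^{k-1}b,\dots,ab^{k-1},b^k\rangle$. Then the number of gaps of $S$ that are divisible by $d$ is \[\frac{(a-1)b^{k+1}-(b-1)a^{k+1}+(b-a)d}{2(b-a)d}+\frac{b^k(1-d)}{2d}.\]
   Context: $\mathbb{N}_0$ denotes the non-negative integers. $\langle g_0,\dots,g_k\rangle$ is the set of $\mathbb{N}_0$-linear combinations of $g_0,\dots,g_k$, and the gaps of $S$ are the elements of $\mathbb{N}_0\setminus S$. -}

module Defs where

open import Data.Nat using (ℕ; zero; suc; _+_; _*_; _∸_; _^_)
open import Data.Fin using (Fin; toℕ)
open import Data.Product using (Σ; _,_)
open import Relation.Binary.PropositionalEquality using (_≡_)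
open import Relation.Nullary using (¬_)

sumFin : (n : ℕ) → (Fin n → ℕ) → ℕ
sumFin zero    f = 0
sumFin (suc n) f = f Data.Fin.zero + sumFin n (λ i → f (Data.Fin.suc i))

gen : ℕ → ℕ → (k : ℕ) → Fin (suc k) → ℕ
gen a b k i = a ^ (k ∸ toℕ i) * b ^ toℕ i

InS : ℕ → ℕ → ℕ → ℕ → Set
InS a b k x = Σ (Fin (suc k) → ℕ) λ c → x ≡ sumFin (suc k) (λ i → c i * gen a b k i)

IsGap : ℕ → ℕ → ℕ → ℕ → Set
IsGap a b k x = ¬ InS a b k x

-- Write S_k for the semigroup and A = a^(k+1). An element of S_(k+1) is c·A + y·b with y ∈ S_k, and
-- since A is invertible modulo b, every x is ≡ A·t (mod b) for exactly one t < b. In that residue class,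
-- x ∈ S_(k+1) iff x = A·t + y·b with y ∈ S_k; so its gaps are A·t + b·(gaps of S_k) together with all
-- class members below A·t. Since d ∣ A and gcd(d, b) = 1, the number G_k of gaps of S_k divisible by d obeys
--   G_(k+1) = b·G_k + Σ_(t<b) ⌊E·t/b⌋,  E = A/d,
-- and pairing t with b − t evaluates the sum to (b − 1)(E − 1)/2. Induction from S_0 = ℕ gives the formula.

module Submission where

open import Defs
open import Data.Fin as Fin using (Fin; toℕ)
open import Function using (_∘_; id)
open import Function.Bundles using (_⇔_; mk⇔; Equivalence)
open import Data.Nat
  using (ℕ; zero; suc; z<s; pred; >-nonZero⁻¹; s≤s⁻¹; _+_; _*_; _∸_; _^_; _<_; _≤_; _≤?_; z≤n; s≤s; NonZero; _/_; _%_)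
open import Data.Nat.Properties
open import Data.Nat.Divisibility using (_∣_; 0∣⇒≡0; ∣m⇒∣m*n; ∣m∣n⇒∣m+n; ∣⇒≤; m%n≡0⇒n∣m; divides; ∣-trans; ∣1⇒≡1; ∣m+n∣m⇒∣n; m∣m*n; n∣m*n)
import Data.Nat.Coprimality as Coprime
open import Data.Nat.GCD using (gcd; module Bézout)
open import Data.Nat.Coprimality using (Coprime; gcd≡1⇒coprime; coprime-Bézout; coprime-divisor)
open import Data.Nat.DivMod using (m≡m%n+[m/n]*n; m%n<n)
open import Data.Nat.Tactic.RingSolver using (solve-∀)
open import Data.List using (List; []; _∷_; map; _++_; length; upTo; downFrom; concatMap)
open import Data.Nat.ListAction using (sum)
open import Data.List.Properties using (map-cong; length-map; length-upTo; length-downFrom; length-++; map-cong-local)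
import Data.List.Relation.Unary.All.Properties as All
import Data.List.Relation.Unary.AllPairs.Properties as AllPairs
open import Data.List.Membership.Propositional using (_∈_; find; lose)
open import Data.List.Membership.Propositional.Properties
  using (∈-map⁺; ∈-map⁻; ∈-upTo⁺; ∈-upTo⁻; ∈-downFrom⁺; ∈-downFrom⁻; ∈-++⁺ˡ; ∈-++⁺ʳ; ∈-++⁻; ∈-concatMap⁺; ∈-concatMap⁻)
open import Data.List.Relation.Binary.Disjoint.Propositional using (Disjoint)
open import Data.List.Relation.Unary.Unique.Propositional using (Unique; [])
import Data.List.Relation.Unary.Unique.Propositional.Properties as Unique
open import Data.Integer using (ℤ; +_; _-_; 0ℤ) renaming (_*_ to _*ℤ_; _+_ to _+ℤ_; _^_ to _^ℤ_)
open import Data.Integer.Properties using (pos-*; pos-+) renaming (*-zeroʳ to *ℤ-zeroʳ)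
open import Data.Integer.Tactic.RingSolver using () renaming (solve-∀ to solve-∀ℤ)
open import Data.Product using (Σ; ∃; ∃₂; _×_; _,_; proj₁; proj₂)
open import Data.Sum using (_⊎_; inj₁; inj₂; [_,_]′)
open import Data.Empty using (⊥-elim)
open import Relation.Nullary using (yes; no)
open import Relation.Binary.PropositionalEquality

-- Congruence modulo n, witnessed without subtraction.
infix 4 _≡_mod_

_≡_mod_ : ℕ → ℕ → ℕ → Set
_≡_mod_ x y n = ∃₂ λ u v → x + u * n ≡ y + v * n

module _ {n : ℕ} where

  ≡mod-sym : ∀ {x y} → x ≡ y mod n → y ≡ x mod n
  ≡mod-sym (u , v , eq) = v , u , sym eq

  ≡mod-trans : ∀ {x y z} → x ≡ y mod n → y ≡ z mod n → x ≡ z mod n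
  ≡mod-trans {x} {y} {z} (u , v , p) (u′ , v′ , q) = u + u′ , v′ + v , (begin
    x + (u + u′) * n     ≡⟨ shuffle n x u u′ ⟩
    (x + u * n) + u′ * n ≡⟨ cong (_+ u′ * n) p ⟩
    (y + v * n) + u′ * n ≡⟨ swap n y v u′ ⟩
    (y + u′ * n) + v * n ≡⟨ cong (_+ v * n) q ⟩
    (z + v′ * n) + v * n ≡⟨ shuffle n z v′ v ⟨
    z + (v′ + v) * n     ∎)
    where
    open ≡-Reasoning
    shuffle : ∀ n x u u′ → x + (u + u′) * n ≡ (x + u * n) + u′ * n
    shuffle = solve-∀
    swap : ∀ n y v u′ → (y + v * n) + u′ * n ≡ (y + u′ * n) + v * n
    swap = solve-∀

  ≡mod-*ˡ : ∀ m {x y} → x ≡ y mod n → m * x ≡ m * y mod n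
  ≡mod-*ˡ m {x} {y} (u , v , eq) = m * u , m * v , (begin
    m * x + m * u * n ≡⟨ distrib n m x u ⟩
    m * (x + u * n)   ≡⟨ cong (m *_) eq ⟩
    m * (y + v * n)   ≡⟨ distrib n m y v ⟨
    m * y + m * v * n ∎)
    where
    open ≡-Reasoning
    distrib : ∀ n m x u → m * x + m * u * n ≡ m * (x + u * n)
    distrib = solve-∀

  +-*-≡mod : ∀ x q → x ≡ x + q * n mod n
  +-*-≡mod x q = q , 0 , sym (+-identityʳ _)

  ∣⇒≡mod : ∀ x {e} → n ∣ e → x ≡ x + e mod n
  ∣⇒≡mod x (divides q refl) = +-*-≡mod x q

  ≡mod⇒∣ : ∀ {x y e} → x ≡ y mod n → x + e ≡ y → n ∣ e
  ≡mod⇒∣ {x} {y} {e} (u , v , eq) x+e≡y = ∣m+n∣m⇒∣n (subst (n ∣_) u*n≡v*n+e (n∣m*n u)) (n∣m*n v)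
    where
    u*n≡v*n+e : u * n ≡ v * n + e
    u*n≡v*n+e = +-cancelˡ-≡ x _ _ (begin
      x + u * n       ≡⟨ eq ⟩
      y + v * n       ≡⟨ cong (_+ v * n) x+e≡y ⟨
      x + e + v * n   ≡⟨ +-assoc x e (v * n) ⟩
      x + (e + v * n) ≡⟨ cong (_+_ x) (+-comm e (v * n)) ⟩
      x + (v * n + e) ∎)
      where open ≡-Reasoning

  ≡mod-split : ∀ {x y} → x ≡ y mod n →
                 (∃ λ q → y ≡ x + q * n) ⊎ (∃ λ q → y + suc q * n ≡ x)
  ≡mod-split {x} {y} x≡y with x ≤? y
  ... | yes x≤y with e , x+e≡y ← m≤n⇒∃[o]m+o≡n x≤y
                with divides q refl ← ≡mod⇒∣ x≡y x+e≡y = inj₁ (q , sym x+e≡y)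
  ... | no x≰y with e , 1+y+e≡x ← m≤n⇒∃[o]m+o≡n (≰⇒> x≰y)
               with y+1+e≡x ← trans (+-suc y e) 1+y+e≡x
               with divides (suc q) eq ← ≡mod⇒∣ (≡mod-sym x≡y) y+1+e≡x =
    inj₂ (q , trans (cong (_+_ y) (sym eq)) y+1+e≡x)

  *-cancelˡ-≡mod : ∀ {m} → Coprime n m → ∀ {x y} → m * x ≡ m * y mod n → x ≡ y mod n
  *-cancelˡ-≡mod {m} n⊥m {x} {y} mx≡my =
    [ (λ x≤y → cancel x≤y mx≡my) , (λ y≤x → ≡mod-sym (cancel y≤x (≡mod-sym mx≡my))) ]′ (≤-total x y)
    where
    cancel : ∀ {x y} → x ≤ y → m * x ≡ m * y mod n → x ≡ y mod n
    cancel {x} x≤y mx≡my with e , refl ← m≤n⇒∃[o]m+o≡n x≤y =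
      ∣⇒≡mod x (coprime-divisor n⊥m (≡mod⇒∣ mx≡my (sym (*-distribˡ-+ m x e))))

  ≡mod-canonical : ∀ {t c} → t < n → t ≡ c mod n → ∃ λ q → c ≡ t + q * n
  ≡mod-canonical {t} {c} t<n t≡c with ≡mod-split t≡c
  ... | inj₁ c≡t+qn = c≡t+qn
  ... | inj₂ (q , c+[1+q]n≡t) = ⊥-elim (<⇒≱ t<n (begin
    n                   ≤⟨ m≤m+n n (q * n) ⟩
    suc q * n           ≤⟨ m≤n+m (suc q * n) c ⟩
    c + suc q * n       ≡⟨ c+[1+q]n≡t ⟩
    t                   ∎))
    where open ≤-Reasoning

  ≡mod-<-injective : ∀ {t t′} → t < n → t′ < n → t ≡ t′ mod n → t ≡ t′
  ≡mod-<-injective {t} t<n t′<n t≡t′ with ≡mod-canonical t<n t≡t′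
  ... | zero , t′≡t+0 = sym (trans t′≡t+0 (+-identityʳ t))
  ... | suc q , refl = ⊥-elim (<⇒≱ t′<n (≤-trans (m≤m+n n (q * n)) (m≤n+m (suc q * n) t)))

  %-≡mod : ∀ m .{{_ : NonZero n}} → m % n ≡ m mod n
  %-≡mod m = m / n , 0 , trans (sym (m≡m%n+[m/n]*n m n)) (sym (+-identityʳ m))

coprime-* : ∀ {m n o} → Coprime m n → Coprime m o → Coprime m (n * o)
coprime-* m⊥n m⊥o (i∣m , i∣no) =
  m⊥o (i∣m , coprime-divisor (λ (j∣i , j∣n) → m⊥n (∣-trans j∣i i∣m , j∣n)) i∣no)

coprime-^ : ∀ {m n} → Coprime m n → ∀ k → Coprime m (n ^ k)
coprime-^ m⊥n zero    (_ , i∣1) = ∣1⇒≡1 i∣1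
coprime-^ m⊥n (suc k) = coprime-* m⊥n (coprime-^ m⊥n k)

coprime-∣ʳ : ∀ {m n o} → Coprime m n → o ∣ n → Coprime m o
coprime-∣ʳ m⊥n o∣n (i∣m , i∣o) = m⊥n (i∣m , ∣-trans i∣o o∣n)

∃-inverse : ∀ {m n} .{{_ : NonZero n}} → Coprime m n → ∃ λ w → m * w ≡ 1 mod n
∃-inverse {m} {n} m⊥n with coprime-Bézout m⊥n
... | Bézout.+- x y 1+yn≡xm = x , 0 , y , trans (+-identityʳ (m * x)) (trans (*-comm m x) (sym 1+yn≡xm))
-- here x·m ≡ −1, so x·(n − 1) is an inverse
∃-inverse {m} {n@(suc n′)} m⊥n | Bézout.-+ x y 1+xm≡yn = x * n′ , 1 , y * n′ , (begin
  m * (x * n′) + 1 * n      ≡⟨ regroup m x n′ ⟩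
  (1 + x * m) * n′ + 1      ≡⟨ cong (λ z → z * n′ + 1) 1+xm≡yn ⟩
  y * n * n′ + 1            ≡⟨ regroup′ y n′ ⟩
  1 + y * n′ * n            ∎)
  where
  open ≡-Reasoning
  regroup : ∀ m x n′ → m * (x * n′) + 1 * suc n′ ≡ (1 + x * m) * n′ + 1
  regroup = solve-∀
  regroup′ : ∀ y n′ → y * suc n′ * n′ + 1 ≡ 1 + y * n′ * suc n′
  regroup′ = solve-∀

∃-residue : ∀ {m n} .{{_ : NonZero n}} → Coprime m n → ∀ x → ∃ λ t → t < n × m * t ≡ x mod n
∃-residue {m} {n} m⊥n x with w , mw≡1 ← ∃-inverse m⊥n =
  (w * x) % n , m%n<n (w * x) n ,
  ≡mod-trans (≡mod-*ˡ m (%-≡mod (w * x)))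
    (subst₂ (_≡_mod n) (trans (*-comm x (m * w)) (*-assoc m w x)) (*-identityʳ x) (≡mod-*ˡ x mw≡1))

congruentBelow : (N n : ℕ) .{{_ : NonZero n}} → List ℕ
congruentBelow N n = map (λ i → N % n + i * n) (upTo (N / n))

module _ {n : ℕ} .{{_ : NonZero n}} where

  ∈-congruentBelow⁻ : ∀ {N z} → z ∈ congruentBelow N n → z < N × N ≡ z mod n
  ∈-congruentBelow⁻ {N} z∈ =
    let i , i∈ , z≡r+in = ∈-map⁻ (λ i → N % n + i * n) z∈
    in subst (_< N) (sym z≡r+in) (begin-strict
         N % n + i * n     <⟨ +-monoʳ-< (N % n) (*-monoˡ-< n (∈-upTo⁻ i∈)) ⟩
         N % n + N / n * n ≡⟨ m≡m%n+[m/n]*n N n ⟨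
         N                 ∎) ,
       subst (N ≡_mod n) (sym z≡r+in) (≡mod-trans (≡mod-sym (%-≡mod N)) (+-*-≡mod (N % n) i))
    where open ≤-Reasoning

  ∈-congruentBelow⁺ : ∀ {N z} → z < N → N ≡ z mod n → z ∈ congruentBelow N n
  ∈-congruentBelow⁺ {N} {z} z<N N≡z =
    let i , z≡r+in = ≡mod-canonical (m%n<n N n) (≡mod-trans (%-≡mod N) N≡z)
        i*n<N/n*n : i * n < N / n * n
        i*n<N/n*n = +-cancelˡ-< (N % n) _ _ (begin-strict
          N % n + i * n     ≡⟨ z≡r+in ⟨
          z                 <⟨ z<N ⟩
          N                 ≡⟨ m≡m%n+[m/n]*n N n ⟩
          N % n + N / n * n ∎)
    in subst (_∈ congruentBelow N n) (sym z≡r+in)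
         (∈-map⁺ (λ i → N % n + i * n) (∈-upTo⁺ (*-cancelʳ-< n i (N / n) i*n<N/n*n)))
    where open ≤-Reasoning

  congruentBelow-unique : ∀ N → Unique (congruentBelow N n)
  congruentBelow-unique N =
    Unique.map⁺ (λ {i} {j} eq → *-cancelʳ-≡ i j n (+-cancelˡ-≡ (N % n) _ _ eq)) (Unique.upTo⁺ (N / n))

  length-congruentBelow : ∀ N → length (congruentBelow N n) ≡ N / n
  length-congruentBelow N = trans (length-map _ (upTo (N / n))) (length-upTo (N / n))

module _ {A : Set} where

  length-concatMap : ∀ (f : A → List ℕ) xs → length (concatMap f xs) ≡ sum (map (length ∘ f) xs)
  length-concatMap f []       = refl
  length-concatMap f (x ∷ xs) = trans (length-++ (f x)) (cong (_+_ (length (f x))) (length-concatMap f xs))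

  sum-map-+ : ∀ (f g : A → ℕ) xs → sum (map (λ x → f x + g x) xs) ≡ sum (map f xs) + sum (map g xs)
  sum-map-+ f g []       = refl
  sum-map-+ f g (x ∷ xs) = trans (cong (_+_ (f x + g x)) (sum-map-+ f g xs))
                                 (interchange (f x) (g x) (sum (map f xs)) (sum (map g xs)))
    where
    interchange : ∀ a b c d → a + b + (c + d) ≡ a + c + (b + d)
    interchange = solve-∀

  sum-map-const : ∀ c (xs : List A) → sum (map (λ _ → c) xs) ≡ length xs * c
  sum-map-const c []       = refl
  sum-map-const c (x ∷ xs) = cong (_+_ c) (sum-map-const c xs)

sum-downFrom-suc : ∀ f n → sum (map f (downFrom (suc n))) ≡ f 0 + sum (map (f ∘ suc) (downFrom n))
sum-downFrom-suc f zero    = refl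
sum-downFrom-suc f (suc n) =
  trans (cong (_+_ (f (suc n))) (sum-downFrom-suc f n)) (+-left-comm (f (suc n)) (f 0) _)
  where
  +-left-comm : ∀ x y z → x + (y + z) ≡ y + (x + z)
  +-left-comm = solve-∀

sum-downFrom-reverse : ∀ f n → sum (map f (downFrom n)) ≡ sum (map (λ i → f (n ∸ suc i)) (downFrom n))
sum-downFrom-reverse f zero    = refl
sum-downFrom-reverse f (suc n) =
  trans (cong (_+_ (f n)) (sum-downFrom-reverse f n)) (sym (sum-downFrom-suc (λ i → f (n ∸ i)) n))

suc-quotient : ∀ q n s e → q * n + s ≡ e * n → 0 < s → s < n + n → suc q ≡ e
suc-quotient q n s e eq 0<s s<2n =
  ≤-antisym (*-cancelʳ-< n q e qn<en) (s≤s⁻¹ (*-cancelʳ-< n e (suc (suc q)) en<[2+q]n))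
  where
  open ≤-Reasoning
  qn<en : q * n < e * n
  qn<en = begin-strict q * n <⟨ m<m+n (q * n) 0<s ⟩ q * n + s ≡⟨ eq ⟩ e * n ∎
  regroup : ∀ q n → q * n + (n + n) ≡ suc (suc q) * n
  regroup = solve-∀
  en<[2+q]n : e * n < suc (suc q) * n
  en<[2+q]n = begin-strict
    e * n             ≡⟨ eq ⟨
    q * n + s         <⟨ +-monoʳ-< (q * n) s<2n ⟩
    q * n + (n + n)   ≡⟨ regroup q n ⟩
    suc (suc q) * n   ∎

module _ {n e : ℕ} .{{_ : NonZero n}} (n⊥e : Coprime n e) where

  %-coprime-pos : ∀ {t} → 0 < t → t < n → 0 < e * t % n
  %-coprime-pos {t@(suc _)} _ t<n = n≢0⇒n>0 λ et%n≡0 →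
    <⇒≱ t<n (∣⇒≤ (coprime-divisor n⊥e (m%n≡0⇒n∣m (e * t) n et%n≡0)))

  /-complement : ∀ {t u} → t + u ≡ n → 0 < t → 0 < u → suc (e * t / n + e * u / n) ≡ e
  /-complement {t} {u} t+u≡n 0<t 0<u =
    suc-quotient (e * t / n + e * u / n) n (e * t % n + e * u % n) e (begin-equality
      (e * t / n + e * u / n) * n + (e * t % n + e * u % n)     ≡⟨ regroup (e * t / n) (e * u / n) n (e * t % n) (e * u % n) ⟩
      (e * t % n + e * t / n * n) + (e * u % n + e * u / n * n) ≡⟨ cong₂ _+_ (m≡m%n+[m/n]*n (e * t) n) (m≡m%n+[m/n]*n (e * u) n) ⟨
      e * t + e * u                                             ≡⟨ *-distribˡ-+ e t u ⟨
      e * (t + u)                                               ≡⟨ cong (e *_) t+u≡n ⟩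
      e * n                                                     ∎)
      (≤-trans (%-coprime-pos 0<t t<n) (m≤m+n (e * t % n) (e * u % n)))
      (+-mono-< (m%n<n (e * t) n) (m%n<n (e * u) n))
    where
    open ≤-Reasoning
    regroup : ∀ q₁ q₂ n r₁ r₂ → (q₁ + q₂) * n + (r₁ + r₂) ≡ (r₁ + q₁ * n) + (r₂ + q₂ * n)
    regroup = solve-∀
    t<n : t < n
    t<n = begin-strict t <⟨ m<m+n t 0<u ⟩ t + u ≡⟨ t+u≡n ⟩ n ∎

sum-/-coprime : ∀ {n e} .{{_ : NonZero n}} → Coprime n e →
                2 * sum (map (λ t → e * t / n) (downFrom n)) + pred n ≡ pred n * e
sum-/-coprime {suc m} {e} b⊥e = begin
  2 * sum (map g (downFrom (suc m))) + m               ≡⟨ cong (λ z → 2 * z + m) (sum-downFrom-suc g m) ⟩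
  2 * (g 0 + ∑h) + m                                   ≡⟨ cong (λ z → 2 * (z + ∑h) + m) g0≡0 ⟩
  2 * (0 + ∑h) + m                                     ≡⟨ regroup ∑h m ⟩
  m * 1 + (∑h + ∑h)                                    ≡⟨ cong (λ z → m * 1 + (∑h + z)) (sum-downFrom-reverse h m) ⟩
  m * 1 + (∑h + sum (map h′ (downFrom m)))             ≡⟨ cong₂ _+_ ∑1≡m (sum-map-+ h h′ (downFrom m)) ⟨
  sum (map (λ _ → 1) (downFrom m)) + sum (map (λ s → h s + h′ s) (downFrom m))
                                                       ≡⟨ sum-map-+ (λ _ → 1) (λ s → h s + h′ s) (downFrom m) ⟨
  sum (map (λ s → suc (h s + h′ s)) (downFrom m))      ≡⟨ cong sum (map-cong-local (All.applyDownFrom⁺₁ id m pair)) ⟩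
  sum (map (λ _ → e) (downFrom m))                     ≡⟨ sum-map-const e (downFrom m) ⟩
  length (downFrom m) * e                              ≡⟨ cong (_* e) (length-downFrom m) ⟩
  m * e                                                ∎
  where
  open ≡-Reasoning
  g : ℕ → ℕ
  g t = e * t / suc m
  h h′ : ℕ → ℕ
  h s = g (suc s)
  h′ s = h (m ∸ suc s)
  ∑h = sum (map h (downFrom m))
  g0≡0 : g 0 ≡ 0
  g0≡0 = cong (_/ suc m) (*-zeroʳ e)
  regroup : ∀ x m → 2 * (0 + x) + m ≡ m * 1 + (x + x)
  regroup = solve-∀
  ∑1≡m : sum (map (λ _ → 1) (downFrom m)) ≡ m * 1
  ∑1≡m = trans (sum-map-const 1 (downFrom m)) (cong (_* 1) (length-downFrom m))
  pair : ∀ {s} → s < m → suc (h s + h′ s) ≡ e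
  pair {s} s<m = /-complement b⊥e (cong suc (trans (+-suc s (m ∸ suc s)) (m+[n∸m]≡n s<m))) (s≤s z≤n) (s≤s z≤n)

sumFin-cong : ∀ n {f g : Fin n → ℕ} → (∀ i → f i ≡ g i) → sumFin n f ≡ sumFin n g
sumFin-cong zero    f≗g = refl
sumFin-cong (suc n) f≗g = cong₂ _+_ (f≗g Fin.zero) (sumFin-cong n (f≗g ∘ Fin.suc))

sumFin-*ʳ : ∀ n (f : Fin n → ℕ) m → sumFin n (λ i → f i * m) ≡ sumFin n f * m
sumFin-*ʳ zero    f m = refl
sumFin-*ʳ (suc n) f m = trans (cong (_+_ (f Fin.zero * m)) (sumFin-*ʳ n (f ∘ Fin.suc) m))
                              (sym (*-distribʳ-+ m (f Fin.zero) (sumFin n (f ∘ Fin.suc))))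

module _ (a b : ℕ) where

  gen-suc : ∀ k i → gen a b (suc k) (Fin.suc i) ≡ gen a b k i * b
  gen-suc k i = regroup (a ^ (k ∸ toℕ i)) b (b ^ toℕ i)
    where
    regroup : ∀ x b y → x * (b * y) ≡ x * y * b
    regroup = solve-∀

  InS-zero : ∀ x → InS a b 0 x
  InS-zero x = (λ _ → x) , sym (trans (+-identityʳ (x * 1)) (*-identityʳ x))

  InS-suc⁻ : ∀ k {x} → InS a b (suc k) x → ∃₂ λ c y → InS a b k y × x ≡ c * a ^ suc k + y * b
  InS-suc⁻ k (c , refl) = c Fin.zero , sumFin (suc k) (λ i → c (Fin.suc i) * gen a b k i) , (c ∘ Fin.suc , refl) ,
    cong₂ _+_ (cong (c Fin.zero *_) (*-identityʳ (a ^ suc k)))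
      (trans (sumFin-cong (suc k) λ i → trans (cong (c (Fin.suc i) *_) (gen-suc k i)) (sym (*-assoc (c (Fin.suc i)) (gen a b k i) b)))
             (sumFin-*ʳ (suc k) (λ i → c (Fin.suc i) * gen a b k i) b))

  InS-suc⁺ : ∀ k c {y} → InS a b k y → InS a b (suc k) (c * a ^ suc k + y * b)
  InS-suc⁺ k c (c′ , refl) = c″ , cong₂ _+_ (cong (c *_) (sym (*-identityʳ (a ^ suc k))))
      (sym (trans (sumFin-cong (suc k) λ i → trans (cong (c′ i *_) (gen-suc k i)) (sym (*-assoc (c′ i) (gen a b k i) b)))
                  (sumFin-*ʳ (suc k) (λ i → c′ i * gen a b k i) b)))
    where
    c″ : Fin (suc (suc k)) → ℕ
    c″ Fin.zero    = c
    c″ (Fin.suc i) = c′ i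

  InS-+-*a^ : ∀ k m {y} → InS a b k y → InS a b k (m * a ^ k + y)
  InS-+-*a^ k m (c , refl) = c′ , regroup m (a ^ k) (c Fin.zero) (sumFin k λ i → c (Fin.suc i) * gen a b k (Fin.suc i))
    where
    c′ : Fin (suc k) → ℕ
    c′ Fin.zero    = m + c Fin.zero
    c′ (Fin.suc i) = c (Fin.suc i)
    regroup : ∀ m p c r → m * p + (c * (p * 1) + r) ≡ (m + c) * (p * 1) + r
    regroup = solve-∀

module _ {a b : ℕ} .{{_ : NonZero b}} (b⊥a : Coprime b a) where

  InS-suc-≡mod : ∀ k {t x} → t < b → InS a b (suc k) x → a ^ suc k * t ≡ x mod b →
                 ∃ λ y → InS a b k y × x ≡ a ^ suc k * t + y * b
  InS-suc-≡mod k {t} {x} t<b x∈S At≡x = shift (InS-suc⁻ a b k x∈S)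
    where
    open ≡-Reasoning
    A = a ^ suc k
    shift : (∃₂ λ c y → InS a b k y × x ≡ c * A + y * b) → ∃ λ y → InS a b k y × x ≡ A * t + y * b
    shift (c , y , y∈S , x≡cA+yb) = q * a * a ^ k + y , InS-+-*a^ a b k (q * a) y∈S , (begin
      x                                 ≡⟨ x≡cA+yb ⟩
      c * A + y * b                     ≡⟨ cong (λ c → c * A + y * b) c≡t+qb ⟩
      (t + q * b) * (a * a ^ k) + y * b ≡⟨ regroup t q b a (a ^ k) y ⟩
      A * t + (q * a * a ^ k + y) * b   ∎)
      where
      x≡Ac : x ≡ A * c mod b
      x≡Ac = 0 , y , trans (+-identityʳ x) (trans x≡cA+yb (cong (_+ y * b) (*-comm c A)))
      t≡c : t ≡ c mod b
      t≡c = *-cancelˡ-≡mod (coprime-^ b⊥a (suc k)) (≡mod-trans At≡x x≡Ac)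
      q = proj₁ (≡mod-canonical t<b t≡c)
      c≡t+qb = proj₂ (≡mod-canonical t<b t≡c)
      regroup : ∀ t q b a p y → (t + q * b) * (a * p) + y * b ≡ a * p * t + (q * a * p + y) * b
      regroup = solve-∀

  InS-suc⇒InS : ∀ k {t y} → t < b → InS a b (suc k) (a ^ suc k * t + y * b) → InS a b k y
  InS-suc⇒InS k {t} {y} t<b x∈S =
    let y′ , y′∈S , eq = InS-suc-≡mod k t<b x∈S (+-*-≡mod _ y)
    in subst (InS a b k) (sym (*-cancelʳ-≡ y y′ b (+-cancelˡ-≡ (a ^ suc k * t) _ _ eq))) y′∈S

  InS-suc⇒≤ : ∀ k {t x} → t < b → InS a b (suc k) x → a ^ suc k * t ≡ x mod b → a ^ suc k * t ≤ x
  InS-suc⇒≤ k {t} t<b x∈S At≡x =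
    let y , _ , x≡At+yb = InS-suc-≡mod k t<b x∈S At≡x
    in ≤-trans (m≤m+n (a ^ suc k * t) (y * b)) (≤-reflexive (sym x≡At+yb))

pos-^ : ∀ m k → + (m ^ k) ≡ (+ m) ^ℤ k
pos-^ m zero    = refl
pos-^ m (suc k) = trans (pos-* m (m ^ k)) (cong (+ m *ℤ_) (pos-^ m k))

pos-pred : ∀ n .{{_ : NonZero n}} → + n - + 1 ≡ + pred n
pos-pred (suc n) = refl

closedForm : ℤ → ℤ → ℤ → ℕ → ℤ
closedForm a b d k = (a - + 1) *ℤ (b ^ℤ suc k) - (b - + 1) *ℤ (a ^ℤ suc k)
                     +ℤ (b - a) *ℤ d +ℤ (b - a) *ℤ (b ^ℤ k) *ℤ (+ 1 - d)

closedForm-zero : ∀ a b d → closedForm a b d 0 ≡ 0ℤ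
closedForm-zero a b d = expand a b d
  where
  expand : ∀ a b d →
    (a - + 1) *ℤ (b *ℤ + 1) - (b - + 1) *ℤ (a *ℤ + 1) +ℤ (b - a) *ℤ d +ℤ (b - a) *ℤ + 1 *ℤ (+ 1 - d) ≡ 0ℤ
  expand = solve-∀ℤ

closedForm-suc : ∀ a b d k →
  closedForm a b d (suc k) ≡ b *ℤ closedForm a b d k +ℤ (b - a) *ℤ (b - + 1) *ℤ (a ^ℤ suc k) - (b - a) *ℤ d *ℤ (b - + 1)
closedForm-suc a b d k = expand a b d (a ^ℤ k) (b ^ℤ k)
  where
  expand : ∀ a b d p q →
    (a - + 1) *ℤ (b *ℤ (b *ℤ q)) - (b - + 1) *ℤ (a *ℤ (a *ℤ p)) +ℤ (b - a) *ℤ d +ℤ (b - a) *ℤ (b *ℤ q) *ℤ (+ 1 - d)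
    ≡ b *ℤ ((a - + 1) *ℤ (b *ℤ q) - (b - + 1) *ℤ (a *ℤ p) +ℤ (b - a) *ℤ d +ℤ (b - a) *ℤ q *ℤ (+ 1 - d))
      +ℤ (b - a) *ℤ (b - + 1) *ℤ (a *ℤ p) - (b - a) *ℤ d *ℤ (b - + 1)
  expand = solve-∀ℤ

closedForm-step : ∀ a b d k {G G′ S E} →
  G′ ≡ b *ℤ G +ℤ S → + 2 *ℤ S +ℤ (b - + 1) ≡ (b - + 1) *ℤ E → E *ℤ d ≡ a ^ℤ suc k →
  + 2 *ℤ (b - a) *ℤ d *ℤ G ≡ closedForm a b d k →
  + 2 *ℤ (b - a) *ℤ d *ℤ G′ ≡ closedForm a b d (suc k)
closedForm-step a b d k {G} {S = S} {E} refl 2S+b-1≡[b-1]E Ed≡a^k+1 IH = begin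
  + 2 *ℤ (b - a) *ℤ d *ℤ (b *ℤ G +ℤ S)
    ≡⟨ split a b d G S ⟩
  b *ℤ (+ 2 *ℤ (b - a) *ℤ d *ℤ G) +ℤ (b - a) *ℤ d *ℤ (+ 2 *ℤ S +ℤ (b - + 1)) - (b - a) *ℤ d *ℤ (b - + 1)
    ≡⟨ cong₂ (λ u v → b *ℤ u +ℤ (b - a) *ℤ d *ℤ v - (b - a) *ℤ d *ℤ (b - + 1)) IH 2S+b-1≡[b-1]E ⟩
  b *ℤ C +ℤ (b - a) *ℤ d *ℤ ((b - + 1) *ℤ E) - (b - a) *ℤ d *ℤ (b - + 1)
    ≡⟨ regroup a b d E C ⟩
  b *ℤ C +ℤ (b - a) *ℤ (b - + 1) *ℤ (E *ℤ d) - (b - a) *ℤ d *ℤ (b - + 1)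
    ≡⟨ cong (λ u → b *ℤ C +ℤ (b - a) *ℤ (b - + 1) *ℤ u - (b - a) *ℤ d *ℤ (b - + 1)) Ed≡a^k+1 ⟩
  b *ℤ C +ℤ (b - a) *ℤ (b - + 1) *ℤ (a ^ℤ suc k) - (b - a) *ℤ d *ℤ (b - + 1)
    ≡⟨ closedForm-suc a b d k ⟨
  closedForm a b d (suc k) ∎
  where
  open ≡-Reasoning
  C = closedForm a b d k
  split : ∀ a b d G S → + 2 *ℤ (b - a) *ℤ d *ℤ (b *ℤ G +ℤ S)
    ≡ b *ℤ (+ 2 *ℤ (b - a) *ℤ d *ℤ G) +ℤ (b - a) *ℤ d *ℤ (+ 2 *ℤ S +ℤ (b - + 1)) - (b - a) *ℤ d *ℤ (b - + 1)
  split = solve-∀ℤ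
  regroup : ∀ a b d E C → b *ℤ C +ℤ (b - a) *ℤ d *ℤ ((b - + 1) *ℤ E) - (b - a) *ℤ d *ℤ (b - + 1)
    ≡ b *ℤ C +ℤ (b - a) *ℤ (b - + 1) *ℤ (E *ℤ d) - (b - a) *ℤ d *ℤ (b - + 1)
  regroup = solve-∀ℤ

module DivisibleGaps {a b d : ℕ} .{{_ : NonZero b}} .{{_ : NonZero d}} (b⊥a : Coprime b a) (d∣a : d ∣ a) where

  DivisibleGap : ℕ → ℕ → Set
  DivisibleGap k x = IsGap a b k x × d ∣ x

  Enumerates : ℕ → List ℕ → Set
  Enumerates k L = Unique L × (∀ x → x ∈ L ⇔ DivisibleGap k x)

  d∣a^suc : ∀ k → d ∣ a ^ suc k
  d∣a^suc k = ∣-trans d∣a (m∣m*n (a ^ k))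

  cofactor : ℕ → ℕ
  cofactor k = _∣_.quotient (d∣a^suc k)

  a^suc*t≡cofactor*t*d : ∀ k t → a ^ suc k * t ≡ cofactor k * t * d
  a^suc*t≡cofactor*t*d k t = trans (cong (_* t) (_∣_.equality (d∣a^suc k))) (regroup (cofactor k) d t)
    where
    regroup : ∀ e d t → e * d * t ≡ e * t * d
    regroup = solve-∀

  b⊥d : Coprime b d
  b⊥d = coprime-∣ʳ b⊥a d∣a

  b⊥cofactor : ∀ k → Coprime b (cofactor k)
  b⊥cofactor k = coprime-∣ʳ (coprime-^ b⊥a (suc k))
    (divides d (trans (_∣_.equality (d∣a^suc k)) (*-comm (cofactor k) d)))

  above : ℕ → List ℕ → ℕ → List ℕ
  above k L t = map (λ y → a ^ suc k * t + y * b) L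

  below : ℕ → ℕ → List ℕ
  below k t = map (_* d) (congruentBelow (cofactor k * t) b)

  block : ℕ → List ℕ → ℕ → List ℕ
  block k L t = above k L t ++ below k t

  ∈-below⁻ : ∀ k t {x} → x ∈ below k t → x < a ^ suc k * t × a ^ suc k * t ≡ x mod b × d ∣ x
  ∈-below⁻ k t {x} x∈ =
    let z , z∈ , x≡zd = ∈-map⁻ (_* d) x∈
        z<Et , Et≡z = ∈-congruentBelow⁻ z∈
    in subst (_< a ^ suc k * t) (sym x≡zd)
         (subst (z * d <_) (sym (a^suc*t≡cofactor*t*d k t)) (*-monoˡ-< d z<Et)) ,
       subst₂ (_≡_mod b) (trans (*-comm d _) (sym (a^suc*t≡cofactor*t*d k t))) (trans (*-comm d z) (sym x≡zd))
         (≡mod-*ˡ d Et≡z) ,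
       divides z x≡zd

  ∈-below⁺ : ∀ k t {x} → x < a ^ suc k * t → a ^ suc k * t ≡ x mod b → d ∣ x → x ∈ below k t
  ∈-below⁺ k t {x} x<At At≡x (divides z x≡zd) =
    subst (_∈ below k t) (sym x≡zd) (∈-map⁺ (_* d) (∈-congruentBelow⁺ z<Et Et≡z))
    where
    z<Et : z < cofactor k * t
    z<Et = *-cancelʳ-< d z (cofactor k * t)
      (subst₂ _<_ x≡zd (a^suc*t≡cofactor*t*d k t) x<At)
    Et≡z : cofactor k * t ≡ z mod b
    Et≡z = *-cancelˡ-≡mod b⊥d
      (subst₂ (_≡_mod b) (trans (a^suc*t≡cofactor*t*d k t) (*-comm _ d)) (trans x≡zd (*-comm z d)) At≡x)

  ∈-block⇔ : ∀ k {L t} → t < b → (∀ y → y ∈ L ⇔ DivisibleGap k y) →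
             ∀ x → x ∈ block k L t ⇔ (DivisibleGap (suc k) x × a ^ suc k * t ≡ x mod b)
  ∈-block⇔ k {L} {t} t<b L⇔ x = mk⇔ to′ from′
    where
    At = a ^ suc k * t
    d∣At : d ∣ At
    d∣At = ∣m⇒∣m*n t (d∣a^suc k)

    to′ : x ∈ block k L t → DivisibleGap (suc k) x × At ≡ x mod b
    to′ x∈ with ∈-++⁻ (above k L t) x∈
    ... | inj₁ x∈above =
      let y , y∈L , x≡At+yb = ∈-map⁻ (λ y → At + y * b) x∈above
          y-gap , d∣y = Equivalence.to (L⇔ y) y∈L
      in ((λ x∈S → y-gap (InS-suc⇒InS b⊥a k t<b (subst (InS a b (suc k)) x≡At+yb x∈S))) ,
          subst (d ∣_) (sym x≡At+yb) (∣m∣n⇒∣m+n d∣At (∣m⇒∣m*n b d∣y))) ,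
         subst (At ≡_mod b) (sym x≡At+yb) (+-*-≡mod At y)
    ... | inj₂ x∈below =
      let x<At , At≡x , d∣x = ∈-below⁻ k t x∈below
      in ((λ x∈S → <⇒≱ x<At (InS-suc⇒≤ b⊥a k t<b x∈S At≡x)) , d∣x) , At≡x

    from′ : DivisibleGap (suc k) x × At ≡ x mod b → x ∈ block k L t
    from′ ((x-gap , d∣x) , At≡x) with ≡mod-split At≡x
    ... | inj₁ (q , x≡At+qb) = ∈-++⁺ˡ (subst (_∈ above k L t) (sym x≡At+qb) (∈-map⁺ (λ y → At + y * b) q∈L))
      where
      q-gap : IsGap a b k q
      q-gap q∈S = x-gap (subst (InS a b (suc k)) (trans (cong (_+ q * b) (*-comm t (a ^ suc k))) (sym x≡At+qb))
                                (InS-suc⁺ a b k t q∈S))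
      d∣q : d ∣ q
      d∣q = coprime-divisor (Coprime.sym b⊥d)
              (subst (d ∣_) (*-comm q b) (∣m+n∣m⇒∣n (subst (d ∣_) x≡At+qb d∣x) d∣At))
      q∈L : q ∈ L
      q∈L = Equivalence.from (L⇔ q) (q-gap , d∣q)
    ... | inj₂ (q , x+[1+q]b≡At) = ∈-++⁺ʳ (above k L t) (∈-below⁺ k t x<At At≡x d∣x)
      where
      x<At : x < At
      x<At = subst (x <_) x+[1+q]b≡At (m<m+n x (≤-trans (>-nonZero⁻¹ b) (m≤m+n b (q * b))))

  block-unique : ∀ k {L} t → Unique L → Unique (block k L t)
  block-unique k {L} t L! = Unique.++⁺ (Unique.map⁺ above-injective L!)
                                       (Unique.map⁺ (λ {z} {z′} → *-cancelʳ-≡ z z′ d) (congruentBelow-unique _))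
                                       above-below-disjoint
    where
    above-injective : ∀ {y y′} → a ^ suc k * t + y * b ≡ a ^ suc k * t + y′ * b → y ≡ y′
    above-injective {y} {y′} eq = *-cancelʳ-≡ y y′ b (+-cancelˡ-≡ (a ^ suc k * t) _ _ eq)
    above-below-disjoint : Disjoint (above k L t) (below k t)
    above-below-disjoint (x∈above , x∈below) =
      let y , _ , x≡At+yb = ∈-map⁻ (λ y → a ^ suc k * t + y * b) x∈above
      in <⇒≱ (proj₁ (∈-below⁻ k t x∈below)) (subst (a ^ suc k * t ≤_) (sym x≡At+yb) (m≤m+n _ (y * b)))

  ∈-block-residue : ∀ k {L i j x} → i < b → j < b → (∀ y → y ∈ L ⇔ DivisibleGap k y) →
                    x ∈ block k L i → x ∈ block k L j → i ≡ j
  ∈-block-residue k {x = x} i<b j<b L⇔ x∈i x∈j =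
    ≡mod-<-injective i<b j<b (*-cancelˡ-≡mod (coprime-^ b⊥a (suc k))
      (≡mod-trans (residue i<b x∈i) (≡mod-sym (residue j<b x∈j))))
    where
    residue : ∀ {t} → t < b → x ∈ block k _ t → a ^ suc k * t ≡ x mod b
    residue t<b x∈ = proj₂ (Equivalence.to (∈-block⇔ k t<b L⇔ x) x∈)

  gaps : ℕ → List ℕ
  gaps zero    = []
  gaps (suc k) = concatMap (block k (gaps k)) (downFrom b)

  gaps-enumerates : ∀ k → Enumerates k (gaps k)
  gaps-enumerates zero    = [] , λ x → mk⇔ (λ ()) (λ (x-gap , _) → ⊥-elim (x-gap (InS-zero a b x)))
  gaps-enumerates (suc k) = unique , λ x → mk⇔ (to′ x) (from′ x)
    where
    L = gaps k
    L! = proj₁ (gaps-enumerates k)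
    L⇔ = proj₂ (gaps-enumerates k)
    unique : Unique (gaps (suc k))
    unique = Unique.concat⁺ (All.map⁺ (All.applyDownFrom⁺₂ id b λ t → block-unique k t L!))
      (AllPairs.map⁺ (AllPairs.applyDownFrom⁺₁ id b λ j<i i<b (x∈i , x∈j) →
        <⇒≢ j<i (sym (∈-block-residue k i<b (<-trans j<i i<b) L⇔ x∈i x∈j))))
    to′ : ∀ x → x ∈ gaps (suc k) → DivisibleGap (suc k) x
    to′ x x∈ = let t , t∈ , x∈block = find (∈-concatMap⁻ (block k L) x∈)
               in proj₁ (Equivalence.to (∈-block⇔ k (∈-downFrom⁻ t∈) L⇔ x) x∈block)
    from′ : ∀ x → DivisibleGap (suc k) x → x ∈ gaps (suc k)
    from′ x x-dgap = let t , t<b , At≡x = ∃-residue (Coprime.sym (coprime-^ b⊥a (suc k))) x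
                     in ∈-concatMap⁺ (block k L)
                          (lose (∈-downFrom⁺ t<b) (Equivalence.from (∈-block⇔ k t<b L⇔ x) (x-dgap , At≡x)))

  length-block : ∀ k L t → length (block k L t) ≡ length L + cofactor k * t / b
  length-block k L t = trans (length-++ (above k L t))
    (cong₂ _+_ (length-map _ L) (trans (length-map (_* d) (congruentBelow (cofactor k * t) b)) (length-congruentBelow (cofactor k * t))))

  length-gaps-suc : ∀ k → length (gaps (suc k)) ≡ b * length (gaps k) + sum (map (λ t → cofactor k * t / b) (downFrom b))
  length-gaps-suc k = begin
    length (concatMap (block k L) (downFrom b))                   ≡⟨ length-concatMap (block k L) (downFrom b) ⟩
    sum (map (length ∘ block k L) (downFrom b))                   ≡⟨ cong sum (map-cong (length-block k L) (downFrom b)) ⟩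
    sum (map (λ t → length L + cofactor k * t / b) (downFrom b))  ≡⟨ sum-map-+ (λ _ → length L) _ (downFrom b) ⟩
    sum (map (λ _ → length L) (downFrom b)) + ∑                   ≡⟨ cong (_+ ∑) (sum-map-const (length L) (downFrom b)) ⟩
    length (downFrom b) * length L + ∑                            ≡⟨ cong (λ n → n * length L + ∑) (length-downFrom b) ⟩
    b * length L + ∑                                              ∎
    where
    open ≡-Reasoning
    L = gaps k
    ∑ = sum (map (λ t → cofactor k * t / b) (downFrom b))

  gaps-count : ∀ k → + 2 *ℤ (+ b - + a) *ℤ + d *ℤ + length (gaps k) ≡ closedForm (+ a) (+ b) (+ d) k
  gaps-count zero    = trans (*ℤ-zeroʳ (+ 2 *ℤ (+ b - + a) *ℤ + d)) (sym (closedForm-zero (+ a) (+ b) (+ d)))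
  gaps-count (suc k) = closedForm-step (+ a) (+ b) (+ d) k G′≡bG+∑ 2∑+b-1≡[b-1]E Ed≡a^k+1 (gaps-count k)
    where
    ∑ = sum (map (λ t → cofactor k * t / b) (downFrom b))
    G′≡bG+∑ : + length (gaps (suc k)) ≡ + b *ℤ + length (gaps k) +ℤ + ∑
    G′≡bG+∑ = trans (cong +_ (length-gaps-suc k)) (trans (pos-+ (b * length (gaps k)) ∑) (cong (_+ℤ + ∑) (pos-* b _)))
    2∑+b-1≡[b-1]E : + 2 *ℤ + ∑ +ℤ (+ b - + 1) ≡ (+ b - + 1) *ℤ + cofactor k
    2∑+b-1≡[b-1]E = begin
      + 2 *ℤ + ∑ +ℤ (+ b - + 1)  ≡⟨ cong (+ 2 *ℤ + ∑ +ℤ_) (pos-pred b) ⟩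
      + 2 *ℤ + ∑ +ℤ + pred b     ≡⟨ cong (_+ℤ + pred b) (pos-* 2 ∑) ⟨
      + (2 * ∑) +ℤ + pred b      ≡⟨ pos-+ (2 * ∑) (pred b) ⟨
      + (2 * ∑ + pred b)         ≡⟨ cong +_ (sum-/-coprime (b⊥cofactor k)) ⟩
      + (pred b * cofactor k)    ≡⟨ pos-* (pred b) (cofactor k) ⟩
      + pred b *ℤ + cofactor k   ≡⟨ cong (_*ℤ + cofactor k) (pos-pred b) ⟨
      (+ b - + 1) *ℤ + cofactor k ∎
      where open ≡-Reasoning
    Ed≡a^k+1 : + cofactor k *ℤ + d ≡ (+ a) ^ℤ suc k
    Ed≡a^k+1 = trans (sym (pos-* (cofactor k) d))
      (trans (cong +_ (sym (_∣_.equality (d∣a^suc k)))) (pos-^ a (suc k)))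

mainTheorem16 : (a b k d : ℕ) → 1 < a → 1 < b → gcd a b ≡ 1 → d ∣ a → 1 ≤ k →
    Σ (List ℕ) λ L →
      Unique L ×
      ((x : ℕ) → (x ∈ L) ⇔ (IsGap a b k x × d ∣ x)) ×
      ((+ 2) *ℤ ((+ b) - (+ a)) *ℤ (+ d) *ℤ (+ length L)
        ≡ ((+ a) - (+ 1)) *ℤ ((+ b) ^ℤ suc k) - ((+ b) - (+ 1)) *ℤ ((+ a) ^ℤ suc k)
          +ℤ ((+ b) - (+ a)) *ℤ (+ d)
          +ℤ ((+ b) - (+ a)) *ℤ ((+ b) ^ℤ k) *ℤ ((+ 1) - (+ d)))
mainTheorem16 a b@(suc _) k d@(suc _) _ _ gcd≡1 d∣a _ =
  gaps k , proj₁ (gaps-enumerates k) , proj₂ (gaps-enumerates k) , gaps-count k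
  where open DivisibleGaps (Coprime.sym (gcd≡1⇒coprime gcd≡1)) d∣a
mainTheorem16 a b k zero 1<a _ _ 0∣a _ = ⊥-elim (<⇒≢ (<-trans z<s 1<a) (sym (0∣⇒≡0 0∣a)))
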